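{- Let $E$ be a finite set, $\Gamma_x$ ($x\in E$) finite groups, $\mathcal{G}=\prod_{x\in E}\Gamma_x$, $\mathcal{H}\le\mathcal{G}$, $b>1$. If $h\in\mathcal{H}$, then $I(h)$ is a flat of $P(\mathcal{H},b)$.
   Context: $\mathcal{H}_S$ is the image of $\mathcal{H}$ under the projection $\mathcal{G}\to\prod_{x\in S}\Gamma_x$ ($\mathcal{H}_\emptyset$ trivial); $P(\mathcal{H},b)=(E,r)$ with $r(S)=\log_b|\mathcal{H}_S|$. A flat of a polymatroid $(E,r)$ is a set $S\subseteq E$ such that $r(S\cup\{x\})>r(S)$ for all $x\notin S$. For $h\in\mathcal{H}$, $I(h)=\{x\in E:h_x=1_{\Gamma_x}\}$. -}

module Defs where

open import Level using (0ℓ)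
open import Data.Nat using (ℕ; _<_)
open import Data.Fin using (Fin)
open import Data.Product using (Σ; ∃; _×_)
open import Data.Sum using (_⊎_)
open import Relation.Nullary using (¬_)
open import Relation.Binary.PropositionalEquality using (_≡_)
open import Algebra.Structures using (IsGroup)

-- A finite group, represented (up to isomorphism) on the carrier Fin order,
-- with the stdlib group structure w.r.t. propositional equality.
record FinGroup : Set where
  field
    order : ℕ
    _∙_   : Fin order → Fin order → Fin order
    ε     : Fin order
    _⁻¹   : Fin order → Fin order
    isGroup : IsGroup _≡_ _∙_ ε _⁻¹

module Product {n : ℕ} (Γ : Fin n → FinGroup) where
  open FinGroup

  G : Set
  G = (x : Fin n) → Fin (order (Γ x))

  _·_ : G → G → G
  (g · g') x = _∙_ (Γ x) (g x) (g' x)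

  one : G
  one x = ε (Γ x)

  inv : G → G
  inv g x = _⁻¹ (Γ x) (g x)

  record IsSubgroup (H : G → Set) : Set where
    field
      one∈ : H one
      ·∈   : ∀ {g g'} → H g → H g' → H (g · g')
      inv∈ : ∀ {g} → H g → H (inv g)

  Subset : Set₁
  Subset = Fin n → Set

  _∪｛_｝ : Subset → Fin n → Subset
  (S ∪｛ x ｝) y = S y ⊎ y ≡ x

  -- g and g' have the same image under the projection 𝒢 → ∏_{x∈S} Γ_x
  AgreeOn : Subset → G → G → Set
  AgreeOn S g g' = ∀ y → S y → g y ≡ g' y

  -- |ℋ_S| = k : ℋ_S (image of ℋ in ∏_{x∈S} Γ_x) has exactly k elements,
  -- witnessed by k elements of ℋ with pairwise distinct projections whose
  -- projections exhaust ℋ_S.  (For S = ∅ this gives k = 1.)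
  ImageCard : (G → Set) → Subset → ℕ → Set
  ImageCard H S k =
    Σ (Fin k → G) λ rep →
      (∀ i → H (rep i)) ×
      (∀ i j → AgreeOn S (rep i) (rep j) → i ≡ j) ×
      (∀ g → H g → ∃ λ i → AgreeOn S g (rep i))

  -- S is a flat of P(ℋ,b) = (E, r), r(S) = log_b |ℋ_S|, b > 1:
  -- for all x ∉ S, r(S ∪ {x}) > r(S), i.e. (log_b strictly increasing)
  -- |ℋ_{S∪{x}}| > |ℋ_S|.
  IsFlat : (G → Set) → Subset → Set
  IsFlat H S = ∀ x → ¬ S x → ∀ k k' →
    ImageCard H S k → ImageCard H (S ∪｛ x ｝) k' → k < k'

  I : G → Subset
  I h x = h x ≡ ε (Γ x)

{-# OPTIONS --safe #-}
-- Restricting from ℋ_{S ∪ {x}} to ℋ_S is a surjection of finite sets.  Since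
-- 1 and h lie in ℋ, agree on S = I(h) and differ at x ∉ I(h), it is not
-- injective, so |ℋ_S| < |ℋ_{S ∪ {x}}|.
module Submission where

open import Defs
open import Data.Nat using (ℕ; suc; _<_; s≤s)
open import Data.Fin using (Fin; punchOut; _≟_)
open import Data.Fin.Properties using (punchOut-injective; injective⇒≤)
open import Data.Product using (Σ; _,_; proj₁; proj₂)
open import Data.Sum using (inj₁; inj₂)
open import Function using (_∘_)
open import Function.Definitions using (Injective)
open import Relation.Nullary using (¬_; yes; no)
open import Relation.Unary using (_⊆_)
open import Relation.Binary.PropositionalEquality

injective-missing⇒< : ∀ {k k'} {s : Fin k → Fin k'} (p : Fin k') →
  Injective _≡_ _≡_ s → (∀ i → s i ≢ p) → k < k'
injective-missing⇒< {k' = suc _} {s} p s-injective s≢p =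
  s≤s (injective⇒≤ {f = λ i → punchOut (s≢p i ∘ sym)} λ {i} {j} eq →
    s-injective (punchOut-injective (s≢p i ∘ sym) (s≢p j ∘ sym) eq))

retraction-nonInjective⇒< : ∀ {k k'} {f : Fin k' → Fin k} {s : Fin k → Fin k'} →
  (∀ i → f (s i) ≡ i) → ∀ {a b} → a ≢ b → f a ≡ f b → k < k'
retraction-nonInjective⇒< {k' = k'} {f} {s} f∘s≗id {a} {b} a≢b fa≡fb =
  injective-missing⇒< (proj₁ missed) s-injective (proj₂ missed)
  where
  s-injective : Injective _≡_ _≡_ s
  s-injective {i} {j} eq = trans (sym (f∘s≗id i)) (trans (cong f eq) (f∘s≗id j))

  misses : ∀ {c} → f c ≡ f a → s (f a) ≢ c → ∀ i → s i ≢ c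
  misses fc≡fa s[fa]≢c i refl = s[fa]≢c (cong s (trans (sym fc≡fa) (f∘s≗id i)))

  -- s hits at most one of the two points a, b of the fibre over f a.
  missed : Σ (Fin k') λ c → ∀ i → s i ≢ c
  missed with s (f a) ≟ a
  ... | yes s[fa]≡a =
    b , misses (sym fa≡fb) (λ s[fa]≡b → a≢b (trans (sym s[fa]≡a) s[fa]≡b))
  ... | no s[fa]≢a = a , misses refl s[fa]≢a

module AgreeOnProperties {n : ℕ} (Γ : Fin n → FinGroup) where
  open Product Γ

  agreeOn-refl : ∀ {S g} → AgreeOn S g g
  agreeOn-refl _ _ = refl

  agreeOn-sym : ∀ {S g g'} → AgreeOn S g g' → AgreeOn S g' g
  agreeOn-sym g~g' y y∈S = sym (g~g' y y∈S)

  agreeOn-trans : ∀ {S g g' g''} → AgreeOn S g g' → AgreeOn S g' g'' → AgreeOn S g g''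
  agreeOn-trans g~g' g'~g'' y y∈S = trans (g~g' y y∈S) (g'~g'' y y∈S)

  agreeOn-antimono : ∀ {S T g g'} → S ⊆ T → AgreeOn T g g' → AgreeOn S g g'
  agreeOn-antimono S⊆T g~g' y y∈S = g~g' y (S⊆T y∈S)

module ImageIndex {n : ℕ} (Γ : Fin n → FinGroup) {H : Product.G Γ → Set}
                  {S : Product.Subset Γ} {k : ℕ} (card : Product.ImageCard Γ H S k) where
  open Product Γ
  open AgreeOnProperties Γ

  rep : Fin k → G
  rep = proj₁ card

  rep∈H : ∀ i → H (rep i)
  rep∈H = proj₁ (proj₂ card)

  index : ∀ {g} → H g → Fin k
  index g∈H = proj₁ (proj₂ (proj₂ (proj₂ card)) _ g∈H)

  index-agree : ∀ {g} (g∈H : H g) → AgreeOn S g (rep (index g∈H))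
  index-agree g∈H = proj₂ (proj₂ (proj₂ (proj₂ card)) _ g∈H)

  index-unique : ∀ {g} (g∈H : H g) {i} → AgreeOn S g (rep i) → index g∈H ≡ i
  index-unique g∈H g~rep =
    proj₁ (proj₂ (proj₂ card)) _ _ (agreeOn-trans (agreeOn-sym (index-agree g∈H)) g~rep)

  index-cong : ∀ {g g'} (g∈H : H g) (g'∈H : H g') → AgreeOn S g g' → index g∈H ≡ index g'∈H
  index-cong g∈H g'∈H g~g' = index-unique g∈H (agreeOn-trans g~g' (index-agree g'∈H))

  index-rep : ∀ i → index (rep∈H i) ≡ i
  index-rep i = index-unique (rep∈H i) agreeOn-refl

  index≡⇒agreeOn : ∀ {g g'} (g∈H : H g) (g'∈H : H g') → index g∈H ≡ index g'∈H → AgreeOn S g g'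
  index≡⇒agreeOn {g' = g'} g∈H g'∈H eq =
    agreeOn-trans (index-agree g∈H)
      (subst (λ i → AgreeOn S (rep i) g') (sym eq) (agreeOn-sym (index-agree g'∈H)))

module _ {n : ℕ} (Γ : Fin n → FinGroup) where
  open Product Γ
  open AgreeOnProperties Γ

  imageCard-strictMono : ∀ {H S T k k' g g'} → S ⊆ T → H g → H g' →
    AgreeOn S g g' → ¬ AgreeOn T g g' →
    ImageCard H S k → ImageCard H T k' → k < k'
  imageCard-strictMono {H = H} {k = k} {k'} S⊆T g∈H g'∈H g~g' g≁g' cardS cardT =
    retraction-nonInjective⇒< {f = restrict} {s = T.index ∘ S.rep∈H}
      (λ i → trans (restrict-index (S.rep∈H i)) (S.index-rep i))
      (g≁g' ∘ T.index≡⇒agreeOn g∈H g'∈H)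
      (begin
        restrict (T.index g∈H)   ≡⟨ restrict-index g∈H ⟩
        S.index g∈H              ≡⟨ S.index-cong g∈H g'∈H g~g' ⟩
        S.index g'∈H             ≡⟨ restrict-index g'∈H ⟨
        restrict (T.index g'∈H)  ∎)
    where
    module S = ImageIndex Γ cardS
    module T = ImageIndex Γ cardT
    open ≡-Reasoning

    restrict : Fin k' → Fin k
    restrict = S.index ∘ T.rep∈H

    restrict-index : ∀ {h} (h∈H : H h) → restrict (T.index h∈H) ≡ S.index h∈H
    restrict-index h∈H =
      S.index-cong _ h∈H (agreeOn-antimono S⊆T (agreeOn-sym (T.index-agree h∈H)))

corollary7p3 : (n : ℕ) (Γ : Fin n → FinGroup) (H : Product.G Γ → Set) →
    Product.IsSubgroup Γ H → (h : Product.G Γ) → H h →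
    Product.IsFlat Γ H (Product.I Γ h)
corollary7p3 n Γ H subgroup h h∈H x x∉I k k' cardI cardI∪x =
  imageCard-strictMono Γ inj₁ one∈ h∈H one~h one≁h cardI cardI∪x
  where
  open Product Γ
  open IsSubgroup subgroup using (one∈)

  one~h : AgreeOn (I h) one h
  one~h y hy≡1 = sym hy≡1

  one≁h : ¬ AgreeOn (I h ∪｛ x ｝) one h
  one≁h agree = x∉I (sym (agree x (inj₂ refl)))
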